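{- Let $m,n$ be coprime positive integers, $\delta=\frac{(m-1)(n-1)}{2}$, and let $\omega$ be an $m$-stable affine permutation with $\Delta:=\Delta_\omega$. Let $\omega_0$ be the unique $m$-stable affine permutation with $\Delta_{\omega_0}=\Delta$ and $\omega_0^{ -1}(1)<\omega_0^{ -1}(2)<\cdots<\omega_0^{ -1}(n)$. Then $$\delta-\mathrm{dinv}(\omega)=\tfrac12\bigl(\mathrm{spin}\,T(\omega)+\mathrm{spin}\,T(\omega_0)\bigr).$$
   Context: An affine permutation is a bijection $\omega:\mathbb{Z}\to\mathbb{Z}$ with $\omega(x+n)=\omega(x)+n$ for all $x$ and $\sum_{i=1}^n\omega(i)=n(n+1)/2$; it is $m$-stable if $\omega(x+m)>\omega(x)$ for all $x$. Set $\Delta_\omega=\{i\in\mathbb{Z}:\omega(i)>0\}$; its $n$-generators (elements $a\in\Delta_\omega$ with $a-n\notin\Delta_\omega$) are exactly $\omega^{ -1}(1),\dots,\omega^{ -1}(n)$. Define $\mathrm{dinv}(\omega)=\delta-\#\{(i,j)\in\mathbb{Z}^2: 1\le i\le n,\ i<j<i+m,\ \omega(i)>\omega(j)\}$. $T(\omega)$ is the standard $m$-ribbon tableau obtained as follows. Content of a box in column $x$, row $y$ is $y-x$; for a partition $\mu$ with rows $\mu_1\ge\mu_2\ge\cdots$ let $M(\mu)=\{r-\mu_r:r\ge1\}$. Let $b_k=\omega^{ -1}(k)$, $\Delta^{(0)}=\Delta$ and $\Delta^{(k)}=(\Delta^{(k-1)}\setminus\{b_k\})\cup\{b_k-m\}$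 for $k=1,\dots,n$. Each $\Delta^{(k)}=M(\lambda^{(k)})$ for a partition $\lambda^{(k)}$, and $\lambda^{(k)}\setminus\lambda^{(k-1)}$ is an $m$-ribbon (connected skew shape of $m$ boxes with no $2\times2$ square); $T(\omega)$ is the chain $\lambda^{(0)}\subset\cdots\subset\lambda^{(n)}$. Its spin is $\sum_k(\text{number of rows met by }\lambda^{(k)}\setminus\lambda^{(k-1)}\;-1)$, which equals $\sum_{k=1}^n\#\{y\in\Delta^{(k-1)}: b_k-m<y<b_k\}$ (the total number of elements "jumped over"). -}

module Defs where

open import Data.Bool using (Bool; true; false; if_then_else_; _∧_; _∨_; not)
open import Data.Nat as ℕ using (ℕ; zero; suc; _∸_)
open import Data.Nat.DivMod using (_/_)
open import Data.Integer as ℤ using (ℤ; +_; _+_; _-_; _<_)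
open import Function.Bundles using (_↔_; Inverse)
open import Relation.Binary.PropositionalEquality using (_≡_)
open import Relation.Nullary.Decidable using (⌊_⌋)
open import Data.Product using (_×_)

app : ℤ ↔ ℤ → ℤ → ℤ
app ω = Inverse.to ω

inv : ℤ ↔ ℤ → ℤ → ℤ
inv ω = Inverse.from ω

sumFromℕ : ℤ → ℕ → (ℤ → ℕ) → ℕ
sumFromℕ a zero    f = 0
sumFromℕ a (suc k) f = f a ℕ.+ sumFromℕ (a + + 1) k f

sumFromℤ : ℤ → ℕ → (ℤ → ℤ) → ℤ
sumFromℤ a zero    f = + 0
sumFromℤ a (suc k) f = f a + sumFromℤ (a + + 1) k f

record IsAffinePerm (n : ℕ) (ω : ℤ ↔ ℤ) : Set where
  field
    periodic : ∀ x → app ω (x + + n) ≡ app ω x + + n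
    sumCond  : sumFromℤ (+ 1) n (app ω) ≡ + ((n ℕ.* suc n) / 2)

IsStable : ℕ → ℤ ↔ ℤ → Set
IsStable m ω = ∀ x → app ω x < app ω (x + + m)

InΔ : ℤ ↔ ℤ → ℤ → Set
InΔ ω i = + 0 < app ω i

δ : ℕ → ℕ → ℕ
δ m n = ((m ∸ 1) ℕ.* (n ∸ 1)) / 2

invCount : ℕ → ℕ → ℤ ↔ ℤ → ℕ
invCount m n ω =
  sumFromℕ (+ 1) n (λ i →
    sumFromℕ (i + + 1) (m ∸ 1) (λ j →
      if ⌊ app ω j ℤ.<? app ω i ⌋ then 1 else 0))

dinv : ℕ → ℕ → ℤ ↔ ℤ → ℤ
dinv m n ω = + δ m n - + invCount m n ω

gen : ℤ ↔ ℤ → ℕ → ℤ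
gen ω k = inv ω (+ k)

-- Decidable membership in Δ^{(k)}:
-- Δ^{(0)} = Δ_ω,  Δ^{(k)} = (Δ^{(k-1)} \ {b_k}) ∪ {b_k - m}.
inΔk : ℕ → ℤ ↔ ℤ → ℕ → ℤ → Bool
inΔk m ω zero    y = ⌊ + 0 ℤ.<? app ω y ⌋
inΔk m ω (suc k) y =
  ⌊ y ℤ.≟ (gen ω (suc k) - + m) ⌋ ∨ (not ⌊ y ℤ.≟ gen ω (suc k) ⌋ ∧ inΔk m ω k y)

-- Number of elements of Δ^{(k)} strictly between b_{k+1} - m and b_{k+1}
-- (the elements jumped over when adding the (k+1)-st ribbon).
jumped : ℕ → ℤ ↔ ℤ → ℕ → ℕ
jumped m ω k =
  sumFromℕ (gen ω (suc k) - + m + + 1) (m ∸ 1)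
    (λ y → if inΔk m ω k y then 1 else 0)

spinT : ℕ → ℕ → ℤ ↔ ℤ → ℕ
spinT m n ω = go n
  where
  go : ℕ → ℕ
  go zero    = 0
  go (suc k) = jumped m ω k ℕ.+ go k

{-# OPTIONS --safe #-}
-- Write b_K = ω⁻¹(K). The elements jumped over by the K-th ribbon lie in (b_K − m, b_K) and are of two
-- kinds: elements y of Δ not yet removed, i.e. ω(y) > K, and earlier shifted generators y = b_j − m with
-- j < K, i.e. 0 < ω(y + m) < K. Summing over K, periodicity turns the first kind into the inversion count
-- inv(ω) = δ − dinv(ω), so spin T(ω) = inv(ω) + G(ω) with G(ω) = #{(K, y) : b_K < y < b_K + m, 0 < ω(y) < K}.
-- Splitting each inversion ω(y) < K = ω(b_K), b_K < y < b_K + m, by whether y ∈ Δ gives inv(ω) = A + G(ω),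
-- where A counts the y ∉ Δ in the windows (b, b + m) over the n-generators b of Δ, so depends only on Δ.
-- When the generators are increasing, G(ω₀) = 0; hence spin T(ω₀) = inv(ω₀) = A and
-- 2 inv(ω) = (inv(ω) + G(ω)) + A = spin T(ω) + spin T(ω₀).

module Submission where

open import Defs
open import Data.Nat as ℕ using (ℕ; zero; suc)
open import Data.Nat.Coprimality using (Coprime)
open import Data.Integer as ℤ using (ℤ; +_; _-_; _*_; _+_)
open import Function.Bundles using (_↔_; _⇔_)
open import Relation.Binary.PropositionalEquality using (_≡_)

open import Data.Bool using (true; false; if_then_else_; T)
open import Data.Empty using (⊥-elim)
open import Data.Integer using (_≤_; _<_; -_; -[1+_])
import Data.Integer.Properties as ℤ
import Data.Nat.Properties as ℕ
open import Data.Integer.DivMod using (n%ℕd<d; a≡a%ℕn+[a/ℕn]*n)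
open import Data.Integer.Tactic.RingSolver using (solve-∀)
open import Algebra.Properties.CommutativeSemigroup ℤ.+-commutativeSemigroup using (xy∙z≈xz∙y)
open import Data.Product using (_×_; _,_)
open import Data.Sum using (_⊎_; inj₁; inj₂)
open import Function.Base using (_∘_)
open import Function.Bundles using (mk⇔; Equivalence; Inverse)
open import Relation.Binary.PropositionalEquality
  using (refl; sym; trans; cong; cong₂; subst; subst₂; _≢_; module ≡-Reasoning)
open import Relation.Binary.Definitions using (tri<; tri≈; tri>)
open import Relation.Nullary using (Dec; yes; no; ¬_)
open import Relation.Nullary.Decidable using (⌊_⌋; _⊎-dec_; _×-dec_; ¬?; T?; toWitness; fromWitness)

open ≡-Reasoning

i+j-j≡i : ∀ i j → i + j - j ≡ i
i+j-j≡i = solve-∀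

i-j+j≡i : ∀ i j → i - j + j ≡ i
i-j+j≡i = solve-∀

𝟙 : {P : Set} → Dec P → ℕ
𝟙 p? = if ⌊ p? ⌋ then 1 else 0

𝟙-⇔ : {P Q : Set} (p? : Dec P) (q? : Dec Q) → P ⇔ Q → 𝟙 p? ≡ 𝟙 q?
𝟙-⇔ (yes _) (yes _) _   = refl
𝟙-⇔ (yes p) (no ¬q) P⇔Q = ⊥-elim (¬q (Equivalence.to P⇔Q p))
𝟙-⇔ (no ¬p) (yes q) P⇔Q = ⊥-elim (¬p (Equivalence.from P⇔Q q))
𝟙-⇔ (no _)  (no _)  _   = refl

𝟙-reject : {P : Set} (p? : Dec P) → ¬ P → 𝟙 p? ≡ 0
𝟙-reject (yes p) ¬p = ⊥-elim (¬p p)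
𝟙-reject (no _)  _  = refl

𝟙-⊎ : {P Q R : Set} (r? : Dec R) (p? : Dec P) (q? : Dec Q) →
      R ⇔ (P ⊎ Q) → (P → ¬ Q) → 𝟙 r? ≡ 𝟙 p? ℕ.+ 𝟙 q?
𝟙-⊎ r? p? q? R⇔P⊎Q disjoint = trans (𝟙-⇔ r? (p? ⊎-dec q?) R⇔P⊎Q) (split p? q?)
  where
  split : (p? : Dec _) (q? : Dec _) → 𝟙 (p? ⊎-dec q?) ≡ 𝟙 p? ℕ.+ 𝟙 q?
  split (yes p) (yes q) = ⊥-elim (disjoint p q)
  split (yes _) (no _)  = refl
  split (no _)  (yes _) = refl
  split (no _)  (no _)  = refl

𝟙-T : ∀ b → (if b then 1 else 0) ≡ 𝟙 (T? b)
𝟙-T true  = refl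
𝟙-T false = refl

InWindow : ℤ → ℕ → ℤ → Set
InWindow a len x = a ≤ x × x < a + + len

window-head : ∀ a len → InWindow a (suc len) a
window-head a len = ℤ.≤-refl , subst (_< a + + suc len) (ℤ.+-identityʳ a) (ℤ.+-monoʳ-< a (ℤ.+<+ ℕ.z<s))

window-tail : ∀ a len {x} → InWindow (a + + 1) len x → InWindow a (suc len) x
window-tail a len (a+1≤x , x<end) =
  ℤ.≤-trans (ℤ.i≤i+j a (+ 1)) a+1≤x , subst (_ <_) (ℤ.+-assoc a (+ 1) (+ len)) x<end

window-untail : ∀ a len {x} → InWindow a (suc len) x → x ≢ a → InWindow (a + + 1) len x
window-untail a len (a≤x , x<end) x≢a =
  subst (_≤ _) (ℤ.+-comm (+ 1) a) (ℤ.i<j⇒suc[i]≤j (ℤ.≤∧≢⇒< a≤x (λ a≡x → x≢a (sym a≡x)))) ,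
  subst (_ <_) (sym (ℤ.+-assoc a (+ 1) (+ len))) x<end

window-above : ∀ {a len y} → InWindow (a + + 1) len y → a < y
window-above {a} (a+1≤y , _) = ℤ.suc[i]≤j⇒i<j (subst (_≤ _) (ℤ.+-comm a (+ 1)) a+1≤y)

sum-cong : ∀ a len {f g : ℤ → ℕ} → (∀ x → InWindow a len x → f x ≡ g x) →
           sumFromℕ a len f ≡ sumFromℕ a len g
sum-cong a zero      _   = refl
sum-cong a (suc len) f≗g =
  cong₂ ℕ._+_ (f≗g a (window-head a len))
              (sum-cong (a + + 1) len (λ x x∈ → f≗g x (window-tail a len x∈)))

sum-zero : ∀ a len {f : ℤ → ℕ} → (∀ x → InWindow a len x → f x ≡ 0) → sumFromℕ a len f ≡ 0
sum-zero a len f≗0 = trans (sum-cong a len f≗0) (zeros a len)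
  where
  zeros : ∀ a len → sumFromℕ a len (λ _ → 0) ≡ 0
  zeros a zero      = refl
  zeros a (suc len) = zeros (a + + 1) len

sum-distrib-+ : ∀ a len (f g : ℤ → ℕ) →
                sumFromℕ a len (λ x → f x ℕ.+ g x) ≡ sumFromℕ a len f ℕ.+ sumFromℕ a len g
sum-distrib-+ a zero      f g = refl
sum-distrib-+ a (suc len) f g =
  trans (cong (f a ℕ.+ g a ℕ.+_) (sum-distrib-+ (a + + 1) len f g)) (+-interchange (f a) (g a) _ _)
  where open import Algebra.Properties.CommutativeSemigroup ℕ.+-commutativeSemigroup
          using () renaming (interchange to +-interchange)

sum-shift : ∀ a c len (f : ℤ → ℕ) → sumFromℕ (a + c) len f ≡ sumFromℕ a len (λ x → f (x + c))
sum-shift a c zero      f = refl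
sum-shift a c (suc len) f = cong (f (a + c) ℕ.+_) (begin
  sumFromℕ (a + c + + 1) len f    ≡⟨ cong (λ s → sumFromℕ s len f) (xy∙z≈xz∙y a c (+ 1)) ⟩
  sumFromℕ (a + + 1 + c) len f    ≡⟨ sum-shift (a + + 1) c len f ⟩
  sumFromℕ (a + + 1) len (λ x → f (x + c)) ∎)
  where
  +-rotate : ∀ a c d → a + c + d ≡ a + d + c
  +-rotate = solve-∀

sum-snoc : ∀ a len (f : ℤ → ℕ) → sumFromℕ a (suc len) f ≡ sumFromℕ a len f ℕ.+ f (a + + len)
sum-snoc a zero      f = trans (ℕ.+-identityʳ (f a)) (cong f (sym (ℤ.+-identityʳ a)))
sum-snoc a (suc len) f = begin
  f a ℕ.+ sumFromℕ (a + + 1) (suc len) f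
    ≡⟨ cong (f a ℕ.+_) (sum-snoc (a + + 1) len f) ⟩
  f a ℕ.+ (sumFromℕ (a + + 1) len f ℕ.+ f (a + + 1 + + len))
    ≡⟨ sym (ℕ.+-assoc (f a) _ _) ⟩
  sumFromℕ a (suc len) f ℕ.+ f (a + + 1 + + len)
    ≡⟨ cong (λ x → sumFromℕ a (suc len) f ℕ.+ f x) (ℤ.+-assoc a (+ 1) (+ len)) ⟩
  sumFromℕ a (suc len) f ℕ.+ f (a + + suc len) ∎

sum-reverse : ∀ a b len (f : ℤ → ℕ) →
              sumFromℕ a len f ≡ sumFromℕ b len (λ x → f (a + b + + len - + 1 - x))
sum-reverse a b zero      f = refl
sum-reverse a b (suc len) f = begin
  f a ℕ.+ sumFromℕ (a + + 1) len f
    ≡⟨ cong (f a ℕ.+_) (sum-reverse (a + + 1) b len f) ⟩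
  f a ℕ.+ sumFromℕ b len (λ x → f (a + + 1 + b + + len - + 1 - x))
    ≡⟨ cong (f a ℕ.+_) (sum-cong b len (λ x _ → cong f (regroup a b (+ len) x))) ⟩
  f a ℕ.+ sumFromℕ b len g
    ≡⟨ ℕ.+-comm (f a) _ ⟩
  sumFromℕ b len g ℕ.+ f a
    ≡⟨ cong (λ y → sumFromℕ b len g ℕ.+ f y) (endpoint a b (+ len)) ⟩
  sumFromℕ b len g ℕ.+ g (b + + len)
    ≡⟨ sym (sum-snoc b len g) ⟩
  sumFromℕ b (suc len) g ∎
  where
  g : ℤ → ℕ
  g x = f (a + b + + suc len - + 1 - x)
  regroup : ∀ a b L x → a + + 1 + b + L - + 1 - x ≡ a + b + (+ 1 + L) - + 1 - x
  regroup = solve-∀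
  endpoint : ∀ a b L → a ≡ a + b + (+ 1 + L) - + 1 - (b + L)
  endpoint = solve-∀

sum-comm : ∀ a len b len′ (F : ℤ → ℤ → ℕ) →
           sumFromℕ a len (λ x → sumFromℕ b len′ (F x)) ≡ sumFromℕ b len′ (λ y → sumFromℕ a len (λ x → F x y))
sum-comm a zero      b len′ F = sym (sum-zero b len′ (λ _ _ → refl))
sum-comm a (suc len) b len′ F = begin
  sumFromℕ b len′ (F a) ℕ.+ sumFromℕ (a + + 1) len (λ x → sumFromℕ b len′ (F x))
    ≡⟨ cong (sumFromℕ b len′ (F a) ℕ.+_) (sum-comm (a + + 1) len b len′ F) ⟩
  sumFromℕ b len′ (F a) ℕ.+ sumFromℕ b len′ (λ y → sumFromℕ (a + + 1) len (λ x → F x y))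
    ≡⟨ sym (sum-distrib-+ b len′ (F a) _) ⟩
  sumFromℕ b len′ (λ y → sumFromℕ a (suc len) (λ x → F x y)) ∎

sum-delta : ∀ a len c (g : ℤ → ℕ) → InWindow a len c →
            sumFromℕ a len (λ x → 𝟙 (x ℤ.≟ c) ℕ.* g x) ≡ g c
sum-delta a zero      c g (a≤c , c<a+0) =
  ⊥-elim (ℤ.≤⇒≯ a≤c (subst (c <_) (ℤ.+-identityʳ a) c<a+0))
sum-delta a (suc len) c g c∈ with a ℤ.≟ c
... | yes refl = begin
  g a ℕ.+ 0 ℕ.+ sumFromℕ (a + + 1) len (λ x → 𝟙 (x ℤ.≟ a) ℕ.* g x)
    ≡⟨ cong (g a ℕ.+ 0 ℕ.+_) (sum-zero (a + + 1) len (λ x x∈ →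
         cong (ℕ._* g x) (𝟙-reject (x ℤ.≟ a) (λ { refl → ℤ.<-irrefl refl (window-above x∈) })))) ⟩
  g a ℕ.+ 0 ℕ.+ 0
    ≡⟨ cong (ℕ._+ 0) (ℕ.+-identityʳ (g a)) ⟩
  g a ℕ.+ 0
    ≡⟨ ℕ.+-identityʳ (g a) ⟩
  g a ∎
... | no a≢c = sum-delta (a + + 1) len c g (window-untail a len c∈ (λ c≡a → a≢c (sym c≡a)))

sum-reindex : ∀ a len (σ τ : ℤ → ℤ) (f : ℤ → ℕ) →
              (∀ x → InWindow a len x → InWindow a len (σ x)) →
              (∀ y → InWindow a len y → InWindow a len (τ y)) →
              (∀ x → InWindow a len x → τ (σ x) ≡ x) →
              (∀ y → InWindow a len y → σ (τ y) ≡ y) →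
              sumFromℕ a len (λ x → f (σ x)) ≡ sumFromℕ a len f
sum-reindex a len σ τ f σ∈ τ∈ τσ στ = begin
  sumFromℕ a len (λ x → f (σ x))
    ≡⟨ sum-cong a len (λ x x∈ → sym (sum-delta a len (σ x) f (σ∈ x x∈))) ⟩
  sumFromℕ a len (λ x → sumFromℕ a len (λ y → 𝟙 (y ℤ.≟ σ x) ℕ.* f y))
    ≡⟨ sum-comm a len a len _ ⟩
  sumFromℕ a len (λ y → sumFromℕ a len (λ x → 𝟙 (y ℤ.≟ σ x) ℕ.* f y))
    ≡⟨ sum-cong a len (λ y y∈ → sum-cong a len (λ x x∈ →
         cong (ℕ._* f y) (𝟙-⇔ (y ℤ.≟ σ x) (x ℤ.≟ τ y) (mk⇔ (τ-side x∈) (σ-side y∈))))) ⟩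
  sumFromℕ a len (λ y → sumFromℕ a len (λ x → 𝟙 (x ℤ.≟ τ y) ℕ.* f y))
    ≡⟨ sum-cong a len (λ y y∈ → sum-delta a len (τ y) (λ _ → f y) (τ∈ y y∈)) ⟩
  sumFromℕ a len f ∎
  where
  τ-side : ∀ {x y} → InWindow a len x → y ≡ σ x → x ≡ τ y
  τ-side x∈ refl = sym (τσ _ x∈)
  σ-side : ∀ {x y} → InWindow a len y → x ≡ τ y → y ≡ σ x
  σ-side y∈ refl = sym (στ _ y∈)

Periodic : ℕ → (ℤ → ℕ) → Set
Periodic n g = ∀ x → g (x + + n) ≡ g x

Equivariant : ℕ → (ℤ → ℤ) → Set
Equivariant n f = ∀ x → f (x + + n) ≡ f x + + n

module _ {n : ℕ} where

  private
    add-multiple : ∀ x T N → x + (+ 1 + T) * N ≡ x + T * N + N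
    add-multiple = solve-∀
    cancel-multiple : ∀ x T N → x + (- (+ 1 + T)) * N + (+ 1 + T) * N ≡ x
    cancel-multiple = solve-∀

  periodic-* : ∀ {g} → Periodic n g → ∀ q x → g (x + q * + n) ≡ g x
  periodic-* {g} per (+ t)    x = multiple t
    where
    multiple : ∀ t → g (x + + t * + n) ≡ g x
    multiple zero    = cong g (ℤ.+-identityʳ x)
    multiple (suc t) = trans (cong g (add-multiple x (+ t) (+ n))) (trans (per _) (multiple t))
  periodic-* {g} per -[1+ t ] x = begin
    g (x + -[1+ t ] * + n)                        ≡⟨ sym (periodic-* {g} per (+ suc t) _) ⟩
    g (x + -[1+ t ] * + n + + suc t * + n)        ≡⟨ cong g (cancel-multiple x (+ t) (+ n)) ⟩
    g x                                           ∎

  equivariant-* : ∀ {f} → Equivariant n f → ∀ q x → f (x + q * + n) ≡ f x + q * + n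
  equivariant-* {f} eqv (+ t)    x = multiple t
    where
    multiple : ∀ t → f (x + + t * + n) ≡ f x + + t * + n
    multiple zero    = trans (cong f (ℤ.+-identityʳ x)) (sym (ℤ.+-identityʳ (f x)))
    multiple (suc t) = begin
      f (x + + suc t * + n)        ≡⟨ cong f (add-multiple x (+ t) (+ n)) ⟩
      f (x + + t * + n + + n)      ≡⟨ eqv _ ⟩
      f (x + + t * + n) + + n      ≡⟨ cong (_+ + n) (multiple t) ⟩
      f x + + t * + n + + n        ≡⟨ sym (add-multiple (f x) (+ t) (+ n)) ⟩
      f x + + suc t * + n          ∎
  equivariant-* {f} eqv -[1+ t ] x = begin
    f y                                          ≡⟨ sym (cancel-multiple′ (f y) (+ t) (+ n)) ⟩
    f y + + suc t * + n + -[1+ t ] * + n         ≡⟨ cong (_+ -[1+ t ] * + n) (sym (equivariant-* {f} eqv (+ suc t) y)) ⟩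
    f (y + + suc t * + n) + -[1+ t ] * + n       ≡⟨ cong (λ z → f z + -[1+ t ] * + n) (cancel-multiple x (+ t) (+ n)) ⟩
    f x + -[1+ t ] * + n                         ∎
    where
    y = x + -[1+ t ] * + n
    cancel-multiple′ : ∀ x T N → x + (+ 1 + T) * N + (- (+ 1 + T)) * N ≡ x
    cancel-multiple′ = solve-∀

sum-periodic-step : ∀ n {g} → Periodic n g → ∀ a → sumFromℕ a n g ≡ sumFromℕ (a + + 1) n g
sum-periodic-step zero     per a = refl
sum-periodic-step (suc n′) {g} per a = begin
  g a ℕ.+ sumFromℕ (a + + 1) n′ g
    ≡⟨ ℕ.+-comm (g a) _ ⟩
  sumFromℕ (a + + 1) n′ g ℕ.+ g a
    ≡⟨ cong (sumFromℕ (a + + 1) n′ g ℕ.+_) (sym (per a)) ⟩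
  sumFromℕ (a + + 1) n′ g ℕ.+ g (a + + suc n′)
    ≡⟨ cong (λ x → sumFromℕ (a + + 1) n′ g ℕ.+ g x) (sym (ℤ.+-assoc a (+ 1) (+ n′))) ⟩
  sumFromℕ (a + + 1) n′ g ℕ.+ g (a + + 1 + + n′)
    ≡⟨ sym (sum-snoc (a + + 1) n′ g) ⟩
  sumFromℕ (a + + 1) (suc n′) g ∎

sum-periodic-shift : ∀ n {g} → Periodic n g → ∀ a d → sumFromℕ a n g ≡ sumFromℕ (a + d) n g
sum-periodic-shift n {g} per a (+ t)    = shift t
  where
  shift : ∀ t → sumFromℕ a n g ≡ sumFromℕ (a + + t) n g
  shift zero    = cong (λ b → sumFromℕ b n g) (sym (ℤ.+-identityʳ a))
  shift (suc t) = trans (shift t)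
    (trans (sum-periodic-step n per (a + + t)) (cong (λ b → sumFromℕ b n g) (+-rotate a (+ t))))
    where
    +-rotate : ∀ a T → a + T + + 1 ≡ a + (+ 1 + T)
    +-rotate = solve-∀
sum-periodic-shift n {g} per a -[1+ t ] = sym (begin
  sumFromℕ (a + -[1+ t ]) n g                ≡⟨ sum-periodic-shift n per (a + -[1+ t ]) (+ suc t) ⟩
  sumFromℕ (a + -[1+ t ] + + suc t) n g      ≡⟨ cong (λ b → sumFromℕ b n g) (cancel a (+ t)) ⟩
  sumFromℕ a n g                             ∎)
  where
  cancel : ∀ a T → a + (- (+ 1 + T)) + (+ 1 + T) ≡ a
  cancel = solve-∀

app-inv : (ω : ℤ ↔ ℤ) → ∀ y → app ω (inv ω y) ≡ y
app-inv ω = Inverse.strictlyInverseˡ ω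

inv-app : (ω : ℤ ↔ ℤ) → ∀ x → inv ω (app ω x) ≡ x
inv-app ω = Inverse.strictlyInverseʳ ω

inv-equivariant : ∀ {n} (ω : ℤ ↔ ℤ) → Equivariant n (app ω) → Equivariant n (inv ω)
inv-equivariant {n} ω eqv y = begin
  inv ω (y + + n)                    ≡⟨ cong (λ z → inv ω (z + + n)) (sym (app-inv ω y)) ⟩
  inv ω (app ω (inv ω y) + + n)      ≡⟨ cong (inv ω) (sym (eqv (inv ω y))) ⟩
  inv ω (app ω (inv ω y + + n))      ≡⟨ inv-app ω _ ⟩
  inv ω y + + n                      ∎

module Residues (n : ℕ) .{{_ : ℕ.NonZero n}} where

  residue : ℤ → ℤ
  residue x = + ((x - + 1) ℤ.%ℕ n) + + 1

  quotient : ℤ → ℤ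
  quotient x = (x - + 1) ℤ./ℕ n

  residue-window : ∀ x → InWindow (+ 1) n (residue x)
  residue-window x =
    ℤ.+≤+ (ℕ.m≤n+m 1 r) , ℤ.+<+ (subst (ℕ._< suc n) (ℕ.+-comm 1 r) (ℕ.s<s (n%ℕd<d (x - + 1) n)))
    where
    r = (x - + 1) ℤ.%ℕ n

  residue-decomposition : ∀ x → x ≡ residue x + quotient x * + n
  residue-decomposition x = begin
    x                                              ≡⟨ sym (i-j+j≡i x (+ 1)) ⟩
    x - + 1 + + 1                                  ≡⟨ cong (_+ + 1) (a≡a%ℕn+[a/ℕn]*n (x - + 1) n) ⟩
    + ((x - + 1) ℤ.%ℕ n) + quotient x * + n + + 1  ≡⟨ xy∙z≈xz∙y (+ ((x - + 1) ℤ.%ℕ n)) (quotient x * + n) (+ 1) ⟩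
    residue x + quotient x * + n                   ∎

  private
    no-smaller-multiple : ∀ {a a′ q q′} → a + q * + n ≡ a′ + q′ * + n → q < q′ →
                          InWindow (+ 1) n a′ → ¬ InWindow (+ 1) n a
    no-smaller-multiple {a} {a′} {q} {q′} e q<q′ (1≤a′ , _) (_ , a<1+n) =
      ℤ.<⇒≱ a<1+n (subst (+ 1 + + n ≤_) a′+[q′-q]n≡a (ℤ.+-mono-≤ 1≤a′ n≤[q′-q]n))
      where
      1≤q′-q : + 1 ≤ q′ - q
      1≤q′-q = subst (_≤ q′ - q) (i+j-j≡i (+ 1) q) (ℤ.+-monoˡ-≤ (- q) (ℤ.i<j⇒suc[i]≤j q<q′))
      n≤[q′-q]n : + n ≤ (q′ - q) * + n
      n≤[q′-q]n = subst (_≤ (q′ - q) * + n) (ℤ.*-identityˡ (+ n)) (ℤ.*-monoʳ-≤-nonNeg (+ n) 1≤q′-q)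
      distrib : ∀ a′ q q′ N → a′ + (q′ - q) * N ≡ a′ + q′ * N - q * N
      distrib = solve-∀
      a′+[q′-q]n≡a : a′ + (q′ - q) * + n ≡ a
      a′+[q′-q]n≡a = begin
        a′ + (q′ - q) * + n          ≡⟨ distrib a′ q q′ (+ n) ⟩
        a′ + q′ * + n - q * + n      ≡⟨ cong (_- q * + n) (sym e) ⟩
        a + q * + n - q * + n        ≡⟨ i+j-j≡i a (q * + n) ⟩
        a                            ∎

  window-unique : ∀ {a a′ q q′} → a + q * + n ≡ a′ + q′ * + n →
                  InWindow (+ 1) n a → InWindow (+ 1) n a′ → a ≡ a′
  window-unique {a} {a′} {q} {q′} e a∈ a′∈ with ℤ.<-cmp q q′
  ... | tri< q<q′ _ _ = ⊥-elim (no-smaller-multiple e q<q′ a′∈ a∈)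
  ... | tri≈ _ refl _ = trans (sym (i+j-j≡i a (q * + n))) (trans (cong (_- q * + n) e) (i+j-j≡i a′ (q * + n)))
  ... | tri> _ _ q′<q = ⊥-elim (no-smaller-multiple (sym e) q′<q a∈ a′∈)

  residue-unique : ∀ {x a} q → x ≡ a + q * + n → InWindow (+ 1) n a → residue x ≡ a
  residue-unique {x} q e a∈ =
    window-unique {q = quotient x} {q′ = q} (trans (sym (residue-decomposition x)) e) (residue-window x) a∈

  residue-fixed : ∀ {a} → InWindow (+ 1) n a → residue a ≡ a
  residue-fixed {a} = residue-unique (+ 0) (sym (ℤ.+-identityʳ a))

  residue-+-* : ∀ x q → residue (x + q * + n) ≡ residue x
  residue-+-* x q = residue-unique (quotient x + q) (begin
    x + q * + n                                   ≡⟨ cong (_+ q * + n) (residue-decomposition x) ⟩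
    residue x + quotient x * + n + q * + n        ≡⟨ distrib (residue x) (quotient x) q (+ n) ⟩
    residue x + (quotient x + q) * + n            ∎) (residue-window x)
    where
    distrib : ∀ r Q q N → r + Q * N + q * N ≡ r + (Q + q) * N
    distrib = solve-∀

  residue-periodic : ∀ {g} → Periodic n g → ∀ x → g (residue x) ≡ g x
  residue-periodic {g} per x =
    sym (trans (cong g (residue-decomposition x)) (periodic-* {n} {g} per (quotient x) (residue x)))

  residue-equivariant : ∀ {f} → Equivariant n f → ∀ x → residue (f (residue x)) ≡ residue (f x)
  residue-equivariant {f} eqv x = sym (begin
    residue (f x)                                     ≡⟨ cong (residue ∘ f) (residue-decomposition x) ⟩
    residue (f (residue x + quotient x * + n))        ≡⟨ cong residue (equivariant-* {n} {f} eqv (quotient x) (residue x)) ⟩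
    residue (f (residue x) + quotient x * + n)        ≡⟨ residue-+-* (f (residue x)) (quotient x) ⟩
    residue (f (residue x))                           ∎)

  -- ω⁻¹(1), …, ω⁻¹(n) represent every residue class mod n exactly once.
  sum-∘-inv : (ω : ℤ ↔ ℤ) → Equivariant n (app ω) → ∀ {g} → Periodic n g →
              sumFromℕ (+ 1) n (λ K → g (inv ω K)) ≡ sumFromℕ (+ 1) n g
  sum-∘-inv ω eqv {g} per = begin
    sumFromℕ (+ 1) n (λ K → g (inv ω K))
      ≡⟨ sum-cong (+ 1) n (λ K _ → sym (residue-periodic per (inv ω K))) ⟩
    sumFromℕ (+ 1) n (λ K → g (residue (inv ω K)))
      ≡⟨ sum-reindex (+ 1) n σ τ g (λ K _ → residue-window (inv ω K)) (λ i _ → residue-window (app ω i)) τσ στ ⟩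
    sumFromℕ (+ 1) n g ∎
    where
    σ τ : ℤ → ℤ
    σ K = residue (inv ω K)
    τ i = residue (app ω i)
    τσ : ∀ K → InWindow (+ 1) n K → τ (σ K) ≡ K
    τσ K K∈ = trans (residue-equivariant {app ω} eqv (inv ω K))
                    (trans (cong residue (app-inv ω K)) (residue-fixed K∈))
    στ : ∀ i → InWindow (+ 1) n i → σ (τ i) ≡ i
    στ i i∈ = trans (residue-equivariant {inv ω} (inv-equivariant ω eqv) (app ω i))
                    (trans (cong residue (inv-app ω i)) (residue-fixed i∈))

SameΔ : ℤ ↔ ℤ → ℤ ↔ ℤ → Set
SameΔ ω ω′ = ∀ x → InΔ ω x ⇔ InΔ ω′ x

IsGenerator : ℕ → ℤ ↔ ℤ → ℤ → Set
IsGenerator n ω a = InΔ ω a × ¬ InΔ ω (a - + n)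

generator-sameΔ : ∀ {n ω ω′} → SameΔ ω ω′ → ∀ a → IsGenerator n ω a ⇔ IsGenerator n ω′ a
generator-sameΔ {n} sameΔ a = mk⇔
  (λ (a∈ , a-n∉) → Equivalence.to (sameΔ a) a∈ , λ a-n∈ → a-n∉ (Equivalence.from (sameΔ (a - + n)) a-n∈))
  (λ (a∈ , a-n∉) → Equivalence.from (sameΔ a) a∈ , λ a-n∈ → a-n∉ (Equivalence.to (sameΔ (a - + n)) a-n∈))

window⇔ : ∀ n K → InWindow (+ 1) n K ⇔ (+ 0 < K × ¬ (+ 0 < K - + n))
window⇔ n K = mk⇔
  (λ (1≤K , K<1+n) → ℤ.suc[i]≤j⇒i<j 1≤K ,
     λ 0<K-n → ℤ.<⇒≱ K<1+n (subst (+ 1 + + n ≤_) (i-j+j≡i K (+ n)) (ℤ.+-monoˡ-≤ (+ n) (ℤ.i<j⇒suc[i]≤j 0<K-n))))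
  (λ (0<K , ¬0<K-n) → ℤ.i<j⇒suc[i]≤j 0<K ,
     ℤ.≤-<-trans (subst (_≤ + n) (i-j+j≡i K (+ n)) (ℤ.+-monoˡ-≤ (+ n) (ℤ.≮⇒≥ ¬0<K-n))) (ℤ.+<+ (ℕ.n<1+n n)))

equivariant-minus : ∀ {n f} → Equivariant n f → ∀ x → f (x - + n) ≡ f x - + n
equivariant-minus {n} {f} eqv x = begin
  f (x - + n)                  ≡⟨ sym (i+j-j≡i (f (x - + n)) (+ n)) ⟩
  f (x - + n) + + n - + n      ≡⟨ cong (_- + n) (sym (eqv (x - + n))) ⟩
  f (x - + n + + n) - + n      ≡⟨ cong (λ y → f y - + n) (i-j+j≡i x (+ n)) ⟩
  f x - + n                    ∎

generator⇔window : ∀ {n} ω → Equivariant n (app ω) → ∀ a → IsGenerator n ω a ⇔ InWindow (+ 1) n (app ω a)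
generator⇔window {n} ω eqv a = mk⇔
  (λ (a∈ , a-n∉) → Equivalence.from (window⇔ n (app ω a)) (a∈ , λ 0<ωa-n → a-n∉ (shifted 0<ωa-n)))
  (λ ωa∈ → let (0<ωa , ¬0<ωa-n) = Equivalence.to (window⇔ n (app ω a)) ωa∈ in
             0<ωa , λ a-n∈ → ¬0<ωa-n (subst (+ 0 <_) (equivariant-minus {n} {app ω} eqv a) a-n∈))
  where
  shifted : + 0 < app ω a - + n → InΔ ω (a - + n)
  shifted = subst (+ 0 <_) (sym (equivariant-minus {n} {app ω} eqv a))

-- Both sums run over the n-generators of Δ, so ω′ ∘ ω⁻¹ permutes [1, n].
sum-inv-sameΔ : ∀ {n} (ω ω′ : ℤ ↔ ℤ) → Equivariant n (app ω) → Equivariant n (app ω′) → SameΔ ω ω′ →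
                (F : ℤ → ℕ) → sumFromℕ (+ 1) n (λ K → F (inv ω K)) ≡ sumFromℕ (+ 1) n (λ K → F (inv ω′ K))
sum-inv-sameΔ {n} ω ω′ eqv eqv′ sameΔ F = begin
  sumFromℕ (+ 1) n (λ K → F (inv ω K))
    ≡⟨ sum-cong (+ 1) n (λ K _ → cong F (sym (inv-app ω′ (inv ω K)))) ⟩
  sumFromℕ (+ 1) n (λ K → F (inv ω′ (σ K)))
    ≡⟨ sum-reindex (+ 1) n σ τ (λ K → F (inv ω′ K)) σ∈ τ∈ (λ K _ → swap ω ω′ K) (λ K _ → swap ω′ ω K) ⟩
  sumFromℕ (+ 1) n (λ K → F (inv ω′ K)) ∎
  where
  σ τ : ℤ → ℤ
  σ K = app ω′ (inv ω K)
  τ K = app ω (inv ω′ K)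
  swap : ∀ ω ω′ K → app ω (inv ω′ (app ω′ (inv ω K))) ≡ K
  swap ω ω′ K = trans (cong (app ω) (inv-app ω′ (inv ω K))) (app-inv ω K)
  inv-generator : ∀ ω → Equivariant n (app ω) → ∀ K → InWindow (+ 1) n K → IsGenerator n ω (inv ω K)
  inv-generator ω eqv K K∈ =
    Equivalence.from (generator⇔window ω eqv (inv ω K)) (subst (InWindow (+ 1) n) (sym (app-inv ω K)) K∈)
  σ∈ : ∀ K → InWindow (+ 1) n K → InWindow (+ 1) n (σ K)
  σ∈ K K∈ = Equivalence.to (generator⇔window ω′ eqv′ (inv ω K))
              (Equivalence.to (generator-sameΔ {n} {ω} {ω′} sameΔ (inv ω K)) (inv-generator ω eqv K K∈))
  τ∈ : ∀ K → InWindow (+ 1) n K → InWindow (+ 1) n (τ K)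
  τ∈ K K∈ = Equivalence.to (generator⇔window ω eqv (inv ω′ K))
              (Equivalence.from (generator-sameΔ {n} {ω} {ω′} sameΔ (inv ω′ K)) (inv-generator ω′ eqv′ K K∈))

Between : ℤ → ℤ → ℤ → Set
Between a b v = a < v × v < b

between? : ∀ a b v → Dec (Between a b v)
between? a b v = (a ℤ.<? v) ×-dec (v ℤ.<? b)

-- Δ^(k) consists of the elements of Δ not yet removed (Remaining k) and the shifted generators b_j − m,
-- j ≤ k (Added k); stability is what prevents b_(k+1) from being one of the earlier b_j − m.
module Ribbons (m : ℕ) (ω : ℤ ↔ ℤ) (stable : IsStable m ω) where

  Remaining : ℕ → ℤ → Set
  Remaining k y = + k < app ω y

  Added : ℕ → ℤ → Set
  Added k y = Between (+ 0) (+ suc k) (app ω (y + + m))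

  private
    nothing-between-0-1 : ∀ {v} → ¬ Between (+ 0) (+ 1) v
    nothing-between-0-1 (0<v , v<1) = ℤ.<⇒≱ v<1 (ℤ.i<j⇒suc[i]≤j 0<v)

    labelled : ∀ {k y} → app ω y ≡ + suc k → y ≡ gen ω (suc k)
    labelled {y = y} e = trans (sym (inv-app ω y)) (cong (inv ω) e)

  remaining-suc : ∀ {k y} → y ≢ gen ω (suc k) → Remaining k y → Remaining (suc k) y
  remaining-suc y≢b k<ωy = ℤ.≤∧≢⇒< (ℤ.i<j⇒suc[i]≤j k<ωy) (λ e → y≢b (labelled (sym e)))

  inΔk-sound : ∀ k y → T (inΔk m ω k y) → Remaining k y ⊎ Added k y
  inΔk-sound zero    y t = inj₁ (toWitness t)
  inΔk-sound (suc k) y t with y ℤ.≟ gen ω (suc k) - + m | y ℤ.≟ gen ω (suc k)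
  ... | yes refl | _      =
    inj₂ (subst (Between (+ 0) (+ suc (suc k))) (sym ω[b-m+m]≡k+1) (ℤ.+<+ ℕ.z<s , ℤ.+<+ (ℕ.n<1+n (suc k))))
    where
    ω[b-m+m]≡k+1 : app ω (gen ω (suc k) - + m + + m) ≡ + suc k
    ω[b-m+m]≡k+1 = trans (cong (app ω) (i-j+j≡i _ (+ m))) (app-inv ω (+ suc k))
  ... | no _     | yes _   = ⊥-elim t
  ... | no _     | no y≢b with inΔk-sound k y t
  ...   | inj₁ k<ωy              = inj₁ (remaining-suc y≢b k<ωy)
  ...   | inj₂ (0<ωy+m , ωy+m<k+1) = inj₂ (0<ωy+m , ℤ.<-trans ωy+m<k+1 (ℤ.+<+ (ℕ.n<1+n (suc k))))

  inΔk-complete : ∀ k y → Remaining k y ⊎ Added k y → T (inΔk m ω k y)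
  inΔk-complete zero    y (inj₁ 0<ωy)    = fromWitness 0<ωy
  inΔk-complete zero    y (inj₂ between) = ⊥-elim (nothing-between-0-1 between)
  inΔk-complete (suc k) y h with y ℤ.≟ gen ω (suc k) - + m | y ℤ.≟ gen ω (suc k)
  ... | yes _   | _      = _
  ... | no y≢b-m | yes refl = ⊥-elim (not-at-b h)
    where
    ωb≡k+1 : app ω (gen ω (suc k)) ≡ + suc k
    ωb≡k+1 = app-inv ω (+ suc k)
    not-at-b : ¬ (Remaining (suc k) (gen ω (suc k)) ⊎ Added (suc k) (gen ω (suc k)))
    not-at-b (inj₁ k+1<ωb)       = ℤ.<-irrefl (sym ωb≡k+1) k+1<ωb
    not-at-b (inj₂ (_ , ωb+m<k+2)) =
      ℤ.<⇒≱ (subst (_< app ω (gen ω (suc k) + + m)) ωb≡k+1 (stable _)) (ℤ.i<j⇒i≤pred[j] ωb+m<k+2)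
  ... | no y≢b-m | no y≢b = inΔk-complete k y (earlier h)
    where
    earlier : Remaining (suc k) y ⊎ Added (suc k) y → Remaining k y ⊎ Added k y
    earlier (inj₁ k+1<ωy)              = inj₁ (ℤ.<-trans (ℤ.+<+ (ℕ.n<1+n k)) k+1<ωy)
    earlier (inj₂ (0<ωy+m , ωy+m<k+2)) = inj₂ (0<ωy+m , ℤ.≤∧≢⇒< (ℤ.i<j⇒i≤pred[j] ωy+m<k+2)
      (λ e → y≢b-m (trans (sym (i+j-j≡i y (+ m))) (cong (_- + m) (labelled e)))))

  𝟙-inΔk : ∀ k y →
           𝟙 (T? (inΔk m ω k y)) ≡ 𝟙 (+ k ℤ.<? app ω y) ℕ.+ 𝟙 (between? (+ 0) (+ suc k) (app ω (y + + m)))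
  𝟙-inΔk k y = 𝟙-⊎ (T? (inΔk m ω k y)) (+ k ℤ.<? app ω y) (between? (+ 0) (+ suc k) (app ω (y + + m)))
    (mk⇔ (inΔk-sound k y) (inΔk-complete k y))
    (λ k<ωy (_ , ωy+m<k+1) → ℤ.<-asym ωy+m<k+1 (ℤ.≤-<-trans (ℤ.i<j⇒suc[i]≤j k<ωy) (stable y)))

<-+-⇔ : ∀ a b c → a < b ⇔ a + c < b + c
<-+-⇔ a b c = mk⇔ (ℤ.+-monoˡ-< c)
  (λ a+c<b+c → subst₂ _<_ (i+j-j≡i a c) (i+j-j≡i b c) (ℤ.+-monoˡ-< (- c) a+c<b+c))

𝟙-<-equivariant : ∀ {n f} → Equivariant n f → ∀ x y → 𝟙 (f (x + + n) ℤ.<? f (y + + n)) ≡ 𝟙 (f x ℤ.<? f y)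
𝟙-<-equivariant {n} {f} eqv x y = begin
  𝟙 (f (x + + n) ℤ.<? f (y + + n))   ≡⟨ cong₂ (λ u v → 𝟙 (u ℤ.<? v)) (eqv x) (eqv y) ⟩
  𝟙 (f x + + n ℤ.<? f y + + n)       ≡⟨ sym (𝟙-⇔ (f x ℤ.<? f y) _ (<-+-⇔ (f x) (f y) (+ n))) ⟩
  𝟙 (f x ℤ.<? f y)                   ∎

sum-window-periodic : ∀ n (s : ℤ → ℤ) len (F : ℤ → ℤ → ℕ) → Equivariant n s →
                      (∀ i j → F (i + + n) (j + + n) ≡ F i j) → Periodic n (λ i → sumFromℕ (s i) len (F i))
sum-window-periodic n s len F eqv F-invariant i = begin
  sumFromℕ (s (i + + n)) len (F (i + + n))                ≡⟨ cong (λ a → sumFromℕ a len (F (i + + n))) (eqv i) ⟩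
  sumFromℕ (s i + + n) len (F (i + + n))                  ≡⟨ sum-shift (s i) (+ n) len (F (i + + n)) ⟩
  sumFromℕ (s i) len (λ j → F (i + + n) (j + + n))        ≡⟨ sum-cong (s i) len (λ j _ → F-invariant i j) ⟩
  sumFromℕ (s i) len (F i)                                ∎

Sorted : ℕ → ℤ ↔ ℤ → Set
Sorted n ω = ∀ i j → 1 ℕ.≤ i → i ℕ.< j → j ℕ.≤ n → gen ω i ℤ.< gen ω j

𝟙-<-split : ∀ {K} v → + 0 < K → 𝟙 (v ℤ.<? K) ≡ 𝟙 (¬? (+ 0 ℤ.<? v)) ℕ.+ 𝟙 (between? (+ 0) K v)
𝟙-<-split {K} v 0<K = 𝟙-⊎ (v ℤ.<? K) (¬? (+ 0 ℤ.<? v)) (between? (+ 0) K v)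
  (mk⇔ split (λ { (inj₁ v≯0) → ℤ.≤-<-trans (ℤ.≮⇒≥ v≯0) 0<K ; (inj₂ (_ , v<K)) → v<K }))
  (λ v≯0 (0<v , _) → v≯0 0<v)
  where
  split : v < K → ¬ (+ 0 < v) ⊎ Between (+ 0) K v
  split v<K with + 0 ℤ.<? v
  ... | yes 0<v = inj₂ (0<v , v<K)
  ... | no  v≯0 = inj₁ v≯0

module Inversions (m′ : ℕ) where

  m : ℕ
  m = suc m′

  -- The two kinds of elements jumped over by the K-th ribbon; the second kind is counted at y + m.
  aboveLeft : ℤ ↔ ℤ → ℤ → ℕ
  aboveLeft ω K = sumFromℕ (inv ω K - + m + + 1) m′ (λ y → 𝟙 (K ℤ.<? app ω y))

  belowRight : ℤ ↔ ℤ → ℤ → ℕ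
  belowRight ω K = sumFromℕ (inv ω K + + 1) m′ (λ y → 𝟙 (between? (+ 0) K (app ω y)))

  gapsAfter : ℤ ↔ ℤ → ℤ → ℕ
  gapsAfter ω x = sumFromℕ (x + + 1) m′ (λ y → 𝟙 (¬? (+ 0 ℤ.<? app ω y)))

  private
    left-end : ∀ b M → b - (+ 1 + M) + + 1 + M ≡ b
    left-end = solve-∀
    right-start : ∀ b M → b - (+ 1 + M) + + 1 + (+ 1 + M) ≡ b + + 1
    right-start = solve-∀

  jumped-split : ∀ ω → IsStable m ω → ∀ k → jumped m ω k ≡ aboveLeft ω (+ suc k) ℕ.+ belowRight ω (+ suc k)
  jumped-split ω stable k = begin
    jumped m ω k
      ≡⟨ sum-cong a m′ (λ y _ → trans (𝟙-T (inΔk m ω k y)) (𝟙-inΔk k y)) ⟩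
    sumFromℕ a m′ (λ y → 𝟙 (+ k ℤ.<? app ω y) ℕ.+ 𝟙 (between? (+ 0) (+ suc k) (app ω (y + + m))))
      ≡⟨ sum-distrib-+ a m′ _ _ ⟩
    sumFromℕ a m′ (λ y → 𝟙 (+ k ℤ.<? app ω y)) ℕ.+
    sumFromℕ a m′ (λ y → 𝟙 (between? (+ 0) (+ suc k) (app ω (y + + m))))
      ≡⟨ cong₂ ℕ._+_ (sum-cong a m′ (λ y y∈ → 𝟙-⇔ _ _ (left-of-b y∈))) (sym (sum-shift a (+ m) m′ _)) ⟩
    aboveLeft ω (+ suc k) ℕ.+ sumFromℕ (a + + m) m′ (λ y → 𝟙 (between? (+ 0) (+ suc k) (app ω y)))
      ≡⟨ cong (λ s → aboveLeft ω (+ suc k) ℕ.+ sumFromℕ s m′ _) (right-start b (+ m′)) ⟩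
    aboveLeft ω (+ suc k) ℕ.+ belowRight ω (+ suc k) ∎
    where
    open Ribbons m ω stable
    b a : ℤ
    b = gen ω (suc k)
    a = b - + m + + 1
    left-of-b : ∀ {y} → InWindow a m′ y → Remaining k y ⇔ Remaining (suc k) y
    left-of-b {y} (_ , y<a+m′) = mk⇔ (remaining-suc (λ y≡b → ℤ.<-irrefl y≡b y<b)) (ℤ.<-trans (ℤ.+<+ (ℕ.n<1+n k)))
      where
      y<b : y < b
      y<b = subst (y <_) (left-end b (+ m′)) y<a+m′

  spinT-split : ∀ ω → IsStable m ω → ∀ N →
                spinT m N ω ≡ sumFromℕ (+ 1) N (λ K → aboveLeft ω K ℕ.+ belowRight ω K)
  spinT-split ω stable zero    = refl
  spinT-split ω stable (suc N) = begin
    jumped m ω N ℕ.+ spinT m N ω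
      ≡⟨ cong₂ ℕ._+_ (jumped-split ω stable N) (spinT-split ω stable N) ⟩
    aboveLeft ω (+ suc N) ℕ.+ belowRight ω (+ suc N) ℕ.+ sumFromℕ (+ 1) N h
      ≡⟨ ℕ.+-comm _ (sumFromℕ (+ 1) N h) ⟩
    sumFromℕ (+ 1) N h ℕ.+ h (+ 1 + + N)
      ≡⟨ sym (sum-snoc (+ 1) N h) ⟩
    sumFromℕ (+ 1) (suc N) h ∎
    where
    h : ℤ → ℕ
    h K = aboveLeft ω K ℕ.+ belowRight ω K


  module _ (n : ℕ) .{{_ : ℕ.NonZero n}} (ω : ℤ ↔ ℤ) (eqv : Equivariant n (app ω)) where

    -- An inversion (i, i + d) is counted at its right end on the left-hand side and at its left end in
    -- invCount; shifting the window [1, n] by d, separately for each gap d, matches the two.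
    sum-aboveLeft : sumFromℕ (+ 1) n (aboveLeft ω) ≡ invCount m n ω
    sum-aboveLeft = begin
      sumFromℕ (+ 1) n (aboveLeft ω)
        ≡⟨ sum-cong (+ 1) n (λ K _ →
             cong (λ v → sumFromℕ (inv ω K - + m + + 1) m′ (λ y → 𝟙 (v ℤ.<? app ω y))) (sym (app-inv ω K))) ⟩
      sumFromℕ (+ 1) n (λ K → largerBefore (inv ω K))
        ≡⟨ Residues.sum-∘-inv n ω eqv largerBefore-periodic ⟩
      sumFromℕ (+ 1) n largerBefore
        ≡⟨ sum-cong (+ 1) n (λ i _ → reflect i) ⟩
      sumFromℕ (+ 1) n (λ i → sumFromℕ (+ 1) m′ (λ d → 𝟙 (app ω i ℤ.<? app ω (i - d))))
        ≡⟨ sum-comm (+ 1) n (+ 1) m′ _ ⟩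
      sumFromℕ (+ 1) m′ (λ d → sumFromℕ (+ 1) n (λ i → 𝟙 (app ω i ℤ.<? app ω (i - d))))
        ≡⟨ sum-cong (+ 1) m′ (λ d _ → gap-shift d) ⟩
      sumFromℕ (+ 1) m′ (λ d → sumFromℕ (+ 1) n (λ i → 𝟙 (app ω (d + i) ℤ.<? app ω i)))
        ≡⟨ sum-comm (+ 1) m′ (+ 1) n _ ⟩
      sumFromℕ (+ 1) n (λ i → sumFromℕ (+ 1) m′ (λ d → 𝟙 (app ω (d + i) ℤ.<? app ω i)))
        ≡⟨ sum-cong (+ 1) n (λ i _ →
             sym (trans (cong (λ s → sumFromℕ s m′ (λ j → 𝟙 (app ω j ℤ.<? app ω i))) (ℤ.+-comm i (+ 1)))
                        (sum-shift (+ 1) i m′ (λ j → 𝟙 (app ω j ℤ.<? app ω i))))) ⟩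
      invCount m n ω ∎
      where
      largerBefore : ℤ → ℕ
      largerBefore i = sumFromℕ (i - + m + + 1) m′ (λ y → 𝟙 (app ω i ℤ.<? app ω y))

      shift-start : ∀ i N M → i + N - M + + 1 ≡ i - M + + 1 + N
      shift-start = solve-∀

      largerBefore-periodic : Periodic n largerBefore
      largerBefore-periodic = sum-window-periodic n (λ i → i - + m + + 1) m′ (λ i y → 𝟙 (app ω i ℤ.<? app ω y))
        (λ i → shift-start i (+ n) (+ m)) (𝟙-<-equivariant eqv)

      reflected : ∀ i M d → i - (+ 1 + M) + + 1 + + 1 + M - + 1 - d ≡ i - d
      reflected = solve-∀

      reflect : ∀ i → largerBefore i ≡ sumFromℕ (+ 1) m′ (λ d → 𝟙 (app ω i ℤ.<? app ω (i - d)))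
      reflect i = trans (sum-reverse (i - + m + + 1) (+ 1) m′ _)
                        (sum-cong (+ 1) m′ (λ d _ → cong (λ y → 𝟙 (app ω i ℤ.<? app ω y)) (reflected i (+ m′) d)))

      gap-shift : ∀ d → sumFromℕ (+ 1) n (λ i → 𝟙 (app ω i ℤ.<? app ω (i - d)))
                      ≡ sumFromℕ (+ 1) n (λ i → 𝟙 (app ω (d + i) ℤ.<? app ω i))
      gap-shift d = begin
        sumFromℕ (+ 1) n g                  ≡⟨ sum-periodic-shift n g-periodic (+ 1) d ⟩
        sumFromℕ (+ 1 + d) n g              ≡⟨ sum-shift (+ 1) d n g ⟩
        sumFromℕ (+ 1) n (λ i → g (i + d))
          ≡⟨ sum-cong (+ 1) n (λ i _ → cong₂ (λ u v → 𝟙 (app ω u ℤ.<? app ω v)) (ℤ.+-comm i d) (i+j-j≡i i d)) ⟩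
        sumFromℕ (+ 1) n (λ i → 𝟙 (app ω (d + i) ℤ.<? app ω i)) ∎
        where
        g : ℤ → ℕ
        g i = 𝟙 (app ω i ℤ.<? app ω (i - d))
        g-periodic : Periodic n g
        g-periodic i = trans (cong (λ v → 𝟙 (app ω (i + + n) ℤ.<? app ω v)) (xy∙z≈xz∙y i (+ n) (- d)))
                             (𝟙-<-equivariant eqv i (i - d))

    invCount-split : invCount m n ω ≡
                     sumFromℕ (+ 1) n (λ K → gapsAfter ω (inv ω K)) ℕ.+ sumFromℕ (+ 1) n (belowRight ω)
    invCount-split = begin
      invCount m n ω
        ≡⟨ sym (Residues.sum-∘-inv n ω eqv smallerAfter-periodic) ⟩
      sumFromℕ (+ 1) n (λ K → smallerAfter (inv ω K))
        ≡⟨ sum-cong (+ 1) n split ⟩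
      sumFromℕ (+ 1) n (λ K → gapsAfter ω (inv ω K) ℕ.+ belowRight ω K)
        ≡⟨ sum-distrib-+ (+ 1) n _ _ ⟩
      sumFromℕ (+ 1) n (λ K → gapsAfter ω (inv ω K)) ℕ.+ sumFromℕ (+ 1) n (belowRight ω) ∎
      where
      smallerAfter : ℤ → ℕ
      smallerAfter i = sumFromℕ (i + + 1) m′ (λ j → 𝟙 (app ω j ℤ.<? app ω i))

      smallerAfter-periodic : Periodic n smallerAfter
      smallerAfter-periodic = sum-window-periodic n (λ i → i + + 1) m′ (λ i j → 𝟙 (app ω j ℤ.<? app ω i))
        (λ i → xy∙z≈xz∙y i (+ n) (+ 1)) (λ i j → 𝟙-<-equivariant eqv j i)

      split : ∀ K → InWindow (+ 1) n K → smallerAfter (inv ω K) ≡ gapsAfter ω (inv ω K) ℕ.+ belowRight ω K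
      split K (1≤K , _) = begin
        smallerAfter (inv ω K)
          ≡⟨ sum-cong b+1 m′ (λ y _ → cong (λ v → 𝟙 (app ω y ℤ.<? v)) (app-inv ω K)) ⟩
        sumFromℕ b+1 m′ (λ y → 𝟙 (app ω y ℤ.<? K))
          ≡⟨ sum-cong b+1 m′ (λ y _ → 𝟙-<-split (app ω y) (ℤ.suc[i]≤j⇒i<j 1≤K)) ⟩
        sumFromℕ b+1 m′ (λ y → 𝟙 (¬? (+ 0 ℤ.<? app ω y)) ℕ.+ 𝟙 (between? (+ 0) K (app ω y)))
          ≡⟨ sum-distrib-+ b+1 m′ _ _ ⟩
        gapsAfter ω (inv ω K) ℕ.+ belowRight ω K ∎
        where
        b+1 = inv ω K + + 1

  -- If the generators are increasing, 0 < ω(y) < K forces y = b_(ω y) < b_K.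
  sum-belowRight-sorted : ∀ n ω → Sorted n ω → sumFromℕ (+ 1) n (belowRight ω) ≡ 0
  sum-belowRight-sorted n ω sorted =
    sum-zero (+ 1) n (λ K (_ , K<1+n) → sum-zero (inv ω K + + 1) m′ (λ y y∈ →
      𝟙-reject (between? (+ 0) K (app ω y)) (λ (0<ωy , ωy<K) →
        ℤ.<-asym (window-above y∈)
                 (subst (_< inv ω K) (inv-app ω y) (sorted-ℤ (app ω y) K 0<ωy ωy<K (ℤ.i<j⇒i≤pred[j] K<1+n))))))
    where
    sorted-ℤ : ∀ J K → + 0 < J → J < K → K ≤ + n → inv ω J < inv ω K
    sorted-ℤ (+ j) (+ k) (ℤ.+<+ 0<j) (ℤ.+<+ j<k) (ℤ.+≤+ k≤n) = sorted j k 0<j j<k k≤n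

  gapsAfter-sameΔ : ∀ {ω ω′} → SameΔ ω ω′ → ∀ x → gapsAfter ω x ≡ gapsAfter ω′ x
  gapsAfter-sameΔ {ω} {ω′} sameΔ x = sum-cong (x + + 1) m′ (λ y _ →
    𝟙-⇔ (¬? (+ 0 ℤ.<? app ω y)) (¬? (+ 0 ℤ.<? app ω′ y))
        (mk⇔ (λ y∉ y∈′ → y∉ (Equivalence.from (sameΔ y) y∈′))
             (λ y∉′ y∈ → y∉′ (Equivalence.to (sameΔ y) y∈))))

  spinT≡invCount+belowRight : ∀ n .{{_ : ℕ.NonZero n}} ω → Equivariant n (app ω) → IsStable m ω →
                              spinT m n ω ≡ invCount m n ω ℕ.+ sumFromℕ (+ 1) n (belowRight ω)
  spinT≡invCount+belowRight n ω eqv stable = begin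
    spinT m n ω
      ≡⟨ spinT-split ω stable n ⟩
    sumFromℕ (+ 1) n (λ K → aboveLeft ω K ℕ.+ belowRight ω K)
      ≡⟨ sum-distrib-+ (+ 1) n _ _ ⟩
    sumFromℕ (+ 1) n (aboveLeft ω) ℕ.+ sumFromℕ (+ 1) n (belowRight ω)
      ≡⟨ cong (ℕ._+ sumFromℕ (+ 1) n (belowRight ω)) (sum-aboveLeft n ω eqv) ⟩
    invCount m n ω ℕ.+ sumFromℕ (+ 1) n (belowRight ω) ∎

  twice-invCount : ∀ n .{{_ : ℕ.NonZero n}} ω ω₀ →
                   Equivariant n (app ω) → IsStable m ω → Equivariant n (app ω₀) → IsStable m ω₀ →
                   SameΔ ω₀ ω → Sorted n ω₀ →
                   2 ℕ.* invCount m n ω ≡ spinT m n ω ℕ.+ spinT m n ω₀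
  twice-invCount n ω ω₀ eqv stable eqv₀ stable₀ sameΔ sorted = begin
    2 ℕ.* I            ≡⟨ cong (I ℕ.+_) (ℕ.+-identityʳ I) ⟩
    I ℕ.+ I            ≡⟨ cong (I ℕ.+_) I≡A+G ⟩
    I ℕ.+ (A ℕ.+ G)    ≡⟨ x∙yz≈xz∙y I A G ⟩
    I ℕ.+ G ℕ.+ A      ≡⟨ cong₂ ℕ._+_ (sym (spinT≡invCount+belowRight n ω eqv stable)) (sym spinT₀≡A) ⟩
    spinT m n ω ℕ.+ spinT m n ω₀ ∎
    where
    open import Algebra.Properties.CommutativeSemigroup ℕ.+-commutativeSemigroup using (x∙yz≈xz∙y)
    I G A : ℕ
    I = invCount m n ω
    G = sumFromℕ (+ 1) n (belowRight ω)
    A = sumFromℕ (+ 1) n (λ K → gapsAfter ω₀ (inv ω₀ K))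
    I≡A+G : I ≡ A ℕ.+ G
    I≡A+G = trans (invCount-split n ω eqv) (cong (ℕ._+ G) (begin
      sumFromℕ (+ 1) n (λ K → gapsAfter ω (inv ω K))
        ≡⟨ sum-cong (+ 1) n (λ K _ → sym (gapsAfter-sameΔ {ω₀} {ω} sameΔ (inv ω K))) ⟩
      sumFromℕ (+ 1) n (λ K → gapsAfter ω₀ (inv ω K))
        ≡⟨ sym (sum-inv-sameΔ ω₀ ω eqv₀ eqv sameΔ (gapsAfter ω₀)) ⟩
      A ∎))
    spinT₀≡A : spinT m n ω₀ ≡ A
    spinT₀≡A = begin
      spinT m n ω₀
        ≡⟨ spinT≡invCount+belowRight n ω₀ eqv₀ stable₀ ⟩
      invCount m n ω₀ ℕ.+ sumFromℕ (+ 1) n (belowRight ω₀)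
        ≡⟨ cong₂ ℕ._+_ (invCount-split n ω₀ eqv₀) (sum-belowRight-sorted n ω₀ sorted) ⟩
      A ℕ.+ sumFromℕ (+ 1) n (belowRight ω₀) ℕ.+ 0
        ≡⟨ cong (λ z → A ℕ.+ z ℕ.+ 0) (sum-belowRight-sorted n ω₀ sorted) ⟩
      A ℕ.+ 0 ℕ.+ 0
        ≡⟨ trans (ℕ.+-identityʳ _) (ℕ.+-identityʳ A) ⟩
      A ∎

lemma3p2 : (m n : ℕ) → 1 ℕ.≤ m → 1 ℕ.≤ n → Coprime m n →
    (ω ω₀ : ℤ ↔ ℤ) →
    IsAffinePerm n ω → IsStable m ω →
    IsAffinePerm n ω₀ → IsStable m ω₀ →
    (∀ x → InΔ ω₀ x ⇔ InΔ ω x) →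
    (∀ i j → 1 ℕ.≤ i → i ℕ.< j → j ℕ.≤ n → gen ω₀ i ℤ.< gen ω₀ j) →
    + 2 * (+ δ m n - dinv m n ω) ≡ + spinT m n ω + + spinT m n ω₀
lemma3p2 zero     _        () _ _ _ _ _ _ _ _ _ _
lemma3p2 (suc _)  zero     _ () _ _ _ _ _ _ _ _ _
lemma3p2 (suc m′) n@(suc _) _ _ _ ω ω₀ affine stable affine₀ stable₀ sameΔ sorted = begin
  + 2 * (+ δ m n - dinv m n ω)
    ≡⟨ cong (+ 2 *_) (d-[d-i]≡i (+ δ m n) (+ invCount m n ω)) ⟩
  + 2 * + invCount m n ω
    ≡⟨ sym (ℤ.pos-* 2 (invCount m n ω)) ⟩
  + (2 ℕ.* invCount m n ω)
    ≡⟨ cong +_ (twice-invCount n ω ω₀ (periodic affine) stable (periodic affine₀) stable₀ sameΔ sorted) ⟩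
  + (spinT m n ω ℕ.+ spinT m n ω₀)
    ≡⟨ ℤ.pos-+ (spinT m n ω) (spinT m n ω₀) ⟩
  + spinT m n ω + + spinT m n ω₀ ∎
  where
  open Inversions m′
  open IsAffinePerm using (periodic)
  d-[d-i]≡i : ∀ d i → d - (d - i) ≡ i
  d-[d-i]≡i = solve-∀
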